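{- Let $G$ and $H$ be connected graphs, each with at least $2$ vertices, such that at least one of $G$ or $H$ has at least $3$ vertices. If $G$ has a perfect matching, then $G\Box H$ is not well-edge-dominated.
   Context: The Cartesian product $G\Box H$ has vertex set $V(G)\times V(H)$, with $(g_1,h_1)$ adjacent to $(g_2,h_2)$ iff either $g_1=g_2$ and $h_1h_2\in E(H)$, or $h_1=h_2$ and $g_1g_2\in E(G)$. A set $F$ of edges is an edge dominating set if every edge not in $F$ shares an endpoint with some edge of $F$; it is minimal if no proper subset is. A graph is well-edge-dominated if all its minimal edge dominating sets have the same cardinality. -}

module Defs where

open import Data.Nat using (ℕ; zero; suc; _+_; _*_)
open import Data.Fin using (Fin; toℕ; quotient; remainder; _≟_)
open import Data.Bool using (Bool; true; false; _∧_; _∨_; if_then_else_)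
open import Data.Product using (Σ; _×_; _,_; ∃)
open import Data.Sum using (_⊎_)
open import Relation.Binary.PropositionalEquality using (_≡_)
open import Relation.Nullary using (¬_)
open import Relation.Nullary.Decidable using (⌊_⌋)
import Data.Nat as ℕ

record Graph : Set where
  constructor mkGraph
  field
    n   : ℕ
    adj : Fin n → Fin n → Bool
open Graph public

record Simple (G : Graph) : Set where
  field
    adj-sym   : ∀ u v → adj G u v ≡ true → adj G v u ≡ true
    adj-irref : ∀ v → adj G v v ≡ false
open Simple public

data Reach (G : Graph) : Fin (n G) → Fin (n G) → Set where
  here : ∀ {v} → Reach G v v
  step : ∀ {u w v} → adj G u w ≡ true → Reach G w v → Reach G u v

Connected : Graph → Set
Connected G = ∀ u v → Reach G u v

-- Cartesian product G □ H on Fin (n G * n H); a vertex x encodes the pair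
-- (quotient x , remainder x) ∈ V(G) × V(H).
_□_ : Graph → Graph → Graph
G □ H = mkGraph (n G * n H) A
  where
  g : Fin (n G * n H) → Fin (n G)
  g = quotient (n H)
  h : Fin (n G * n H) → Fin (n H)
  h = remainder {n G} (n H)
  A : Fin (n G * n H) → Fin (n G * n H) → Bool
  A x y = (⌊ g x ≟ g y ⌋ ∧ adj H (h x) (h y)) ∨ (⌊ h x ≟ h y ⌋ ∧ adj G (g x) (g y))

record EdgeSet (G : Graph) : Set where
  field
    mem     : Fin (n G) → Fin (n G) → Bool
    mem-sym : ∀ u v → mem u v ≡ true → mem v u ≡ true
    mem-adj : ∀ u v → mem u v ≡ true → adj G u v ≡ true
open EdgeSet public

sumFin : (k : ℕ) → (Fin k → ℕ) → ℕ
sumFin zero    f = 0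
sumFin (suc k) f = f Fin.zero + sumFin k (λ i → f (Fin.suc i))
  where import Data.Fin as Fin

-- cardinality of an edge set: each edge {u,v} counted once, via toℕ u < toℕ v
card : {G : Graph} → EdgeSet G → ℕ
card {G} F = sumFin (n G) λ u → sumFin (n G) λ v →
  if ⌊ toℕ u ℕ.<? toℕ v ⌋ ∧ mem F u v then 1 else 0

IsEDS : {G : Graph} → EdgeSet G → Set
IsEDS {G} F = ∀ u v → adj G u v ≡ true → mem F u v ≡ false →
  ∃ λ w → (mem F u w ≡ true ⊎ mem F v w ≡ true)

_⊂E_ : {G : Graph} → EdgeSet G → EdgeSet G → Set
_⊂E_ {G} F' F = (∀ u v → mem F' u v ≡ true → mem F u v ≡ true)
  × (∃ λ u → ∃ λ v → mem F u v ≡ true × mem F' u v ≡ false)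

IsMinimalEDS : {G : Graph} → EdgeSet G → Set
IsMinimalEDS {G} F = IsEDS F × (∀ (F' : EdgeSet G) → F' ⊂E F → ¬ IsEDS F')

WellEdgeDominated : Graph → Set
WellEdgeDominated G = ∀ (F F' : EdgeSet G) → IsMinimalEDS F → IsMinimalEDS F' → card F ≡ card F'

HasPerfectMatching : Graph → Set
HasPerfectMatching G = Σ (EdgeSet G) λ M → ∀ v →
  ∃ λ u → mem M v u ≡ true × (∀ w → mem M v w ≡ true → w ≡ u)

module Submission where

-- A perfect matching P of G lifts to a perfect matching of G □ H, and every
-- maximal matching is a minimal edge dominating set. Inside a small grid of
-- G □ H (two P-mates times a path abc of H, or mates g₀g₁, g₂g₃ with g₁g₂ ∈ E(G)
-- times an edge ab of H) there is a path v₀…v₅ whose pairs v₀v₁, v₂v₃, v₄v₅ are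
-- P-mates and whose ends are non-adjacent. Trading those three pairs for v₁v₂
-- and v₃v₄ leaves a maximal matching with one edge fewer. Sizes are compared
-- by the handshake lemma: twice the size of a matching is the number of
-- matched vertices.

open import Defs

open import Data.Bool using (Bool; true; false; _∧_; _∨_; if_then_else_)
open import Data.Bool.Properties using (∧-zeroʳ; ∨-zeroʳ)
open import Data.Empty using (⊥; ⊥-elim)
open import Data.Fin using (Fin; zero; suc; toℕ; punchIn; punchOut; combine; quotient; remainder)
open import Data.Fin.Patterns using (0F; 1F; 2F; 3F; 4F; 5F)
open import Data.Fin.Properties
  using ( _≟_; toℕ-injective; any?; all?; punchInᵢ≢i; punchIn-injective; punchIn-punchOut
        ; combine-remQuot; remQuot-combine; combine-injectiveˡ; combine-injectiveʳ)
open import Data.Maybe using (Maybe; just; nothing; is-just; map)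
open import Data.Maybe.Properties using (just-injective)
open import Data.Nat as ℕ using (ℕ; _+_; _*_; _≤_; _<?_; s≤s)
open import Data.Nat.Properties using (<⇒≤; +-0-commutativeMonoid; +-identityʳ; m+1+n≢m; <-asym; ≤-antisym; ≮⇒≥)
open import Data.Product using (Σ; ∃; ∃₂; _×_; _,_; proj₁; proj₂)
open import Data.Product.Properties using (≡-dec)
open import Data.Sum using (_⊎_; inj₁; inj₂; [_,_])
open import Data.Vec using (Vec; []; _∷_; lookup)
open import Data.Vec.Relation.Unary.All using ([]; _∷_)
open import Data.Vec.Relation.Unary.AllPairs using ([]; _∷_)
open import Data.Vec.Relation.Unary.Unique.Propositional using (Unique)
open import Data.Vec.Relation.Unary.Unique.Propositional.Properties using (lookup-injective)
open import Function using (_∘_)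
open import Function.Definitions using (Injective)
open import Relation.Binary.Definitions using (DecidableEquality)
open import Relation.Binary.PropositionalEquality
  using (_≡_; _≢_; refl; sym; trans; cong; cong₂; subst; ≡-≟-identity; module ≡-Reasoning)
open import Relation.Nullary using (¬_; Dec; does; yes; no; contradiction; _⊎-dec_)
open import Relation.Nullary.Decidable using (⌊_⌋; True; toWitness; dec-true; dec-no; _→-dec_)
open import Relation.Unary using (Decidable)
open import Algebra.Properties.CommutativeMonoid.Sum +-0-commutativeMonoid
  using (sum; sum-syntax; ∑-comm; ∑-distrib-+; sum-cong-≗; sum-replicate-zero)

χ : Bool → ℕ
χ b = if b then 1 else 0

sumFin≡sum : ∀ k (f : Fin k → ℕ) → sumFin k f ≡ sum f
sumFin≡sum ℕ.zero    f = refl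
sumFin≡sum (ℕ.suc k) f = cong (f zero +_) (sumFin≡sum k (f ∘ suc))

sum-δ : ∀ {k} (z : Fin k) → ∑[ y < k ] χ (does (z ≟ y)) ≡ 1
sum-δ {ℕ.suc k} zero    = cong ℕ.suc (sum-replicate-zero k)
sum-δ {ℕ.suc k} (suc z) = sum-δ z

sum-1 : ∀ k → ∑[ i < k ] 1 ≡ k
sum-1 ℕ.zero    = refl
sum-1 (ℕ.suc k) = cong ℕ.suc (sum-1 k)

adj⇒≢ : ∀ {Γ} → Simple Γ → ∀ {x y} → adj Γ x y ≡ true → x ≢ y
adj⇒≢ simple {x} xx refl = contradiction (trans (sym xx) (adj-irref simple x)) λ ()

degree : {Γ : Graph} → EdgeSet Γ → Fin (n Γ) → ℕ
degree {Γ} F x = ∑[ y < n Γ ] χ (mem F x y)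

module _ {Γ : Graph} (simple : Simple Γ) (F : EdgeSet Γ) where

  private
    ordered : Fin (n Γ) → Fin (n Γ) → ℕ
    ordered x y = χ (⌊ toℕ x <? toℕ y ⌋ ∧ mem F x y)

    mem-comm : ∀ x y → mem F y x ≡ mem F x y
    mem-comm x y with mem F x y in xy | mem F y x in yx
    ... | true  | true  = refl
    ... | false | false = refl
    ... | true  | false = sym (trans (sym (mem-sym F x y xy)) yx)
    ... | false | true  = trans (sym (mem-sym F y x yx)) xy

    mem-irrefl : ∀ x → mem F x x ≡ false
    mem-irrefl x with mem F x x in xx
    ... | false = refl
    ... | true  = sym (trans (sym (adj-irref simple x)) (mem-adj F x x xx))

    ordered-both : ∀ x y → ordered x y + ordered y x ≡ χ (mem F x y)
    ordered-both x y with toℕ x <? toℕ y | toℕ y <? toℕ x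
    ... | yes x<y | yes y<x = ⊥-elim (<-asym x<y y<x)
    ... | yes _   | no _    = +-identityʳ _
    ... | no _    | yes _   = cong χ (mem-comm x y)
    ... | no x≮y  | no y≮x  = cong χ (sym (subst (λ z → mem F x z ≡ false) x≡y (mem-irrefl x)))
      where x≡y = toℕ-injective (≤-antisym (≮⇒≥ y≮x) (≮⇒≥ x≮y))

  handshake : card F + card F ≡ ∑[ x < n Γ ] degree F x
  handshake = begin
    card F + card F
      ≡⟨ cong₂ _+_ card≡ (trans card≡ (∑-comm ordered)) ⟩
    (∑[ x < n Γ ] ∑[ y < n Γ ] ordered x y) + (∑[ x < n Γ ] ∑[ y < n Γ ] ordered y x)
      ≡⟨ sym (∑-distrib-+ (λ x → ∑[ y < n Γ ] ordered x y) (λ x → ∑[ y < n Γ ] ordered y x)) ⟩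
    ∑[ x < n Γ ] ((∑[ y < n Γ ] ordered x y) + (∑[ y < n Γ ] ordered y x))
      ≡⟨ sum-cong-≗ (λ x → sym (∑-distrib-+ (ordered x) (λ y → ordered y x))) ⟩
    ∑[ x < n Γ ] ∑[ y < n Γ ] (ordered x y + ordered y x)
      ≡⟨ sum-cong-≗ (λ x → sum-cong-≗ (ordered-both x)) ⟩
    ∑[ x < n Γ ] degree F x ∎
    where
    open ≡-Reasoning
    card≡ : card F ≡ ∑[ x < n Γ ] ∑[ y < n Γ ] ordered x y
    card≡ = trans (sumFin≡sum (n Γ) _) (sum-cong-≗ (λ x → sumFin≡sum (n Γ) (ordered x)))

pointsTo : ∀ {k} → Maybe (Fin k) → Fin k → Bool
pointsTo nothing  y = false
pointsTo (just z) y = does (z ≟ y)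

pointsTo-just : ∀ {k} (y : Fin k) → pointsTo (just y) y ≡ true
pointsTo-just y = dec-true (y ≟ y) refl

pointsTo⇒≡just : ∀ {k} (m : Maybe (Fin k)) y → pointsTo m y ≡ true → m ≡ just y
pointsTo⇒≡just (just z) y p with z ≟ y
... | yes refl = refl

record Matching (Γ : Graph) : Set where
  field
    partner     : Fin (n Γ) → Maybe (Fin (n Γ))
    partner-sym : ∀ x y → partner x ≡ just y → partner y ≡ just x
    partner-adj : ∀ x y → partner x ≡ just y → adj Γ x y ≡ true
open Matching public

module _ {Γ : Graph} (M : Matching Γ) where

  edges : EdgeSet Γ
  edges = record
    { mem     = λ x → pointsTo (partner M x)
    ; mem-sym = λ x y p → subst (λ m → pointsTo m x ≡ true)
                            (sym (partner-sym M x y (pointsTo⇒≡just _ y p))) (pointsTo-just x)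
    ; mem-adj = λ x y p → partner-adj M x y (pointsTo⇒≡just _ y p)
    }

  Maximal : Set
  Maximal = ∀ x y → adj Γ x y ≡ true → partner M x ≡ nothing → partner M y ≡ nothing → ⊥

  maximal⇒EDS : Maximal → IsEDS edges
  maximal⇒EDS maximal x y xy _ with partner M x in px | partner M y in py
  ... | just z  | _       = z , inj₁ (pointsTo-just z)
  ... | nothing | just z  = z , inj₂ (pointsTo-just z)
  ... | nothing | nothing = ⊥-elim (maximal x y xy px py)

  edges-functional : ∀ x a b → mem edges x a ≡ true → mem edges x b ≡ true → a ≡ b
  edges-functional x a b xa xb =
    just-injective (trans (sym (pointsTo⇒≡just (partner M x) a xa)) (pointsTo⇒≡just (partner M x) b xb))

  -- An edge xy of M omitted from F' is dominated by an edge of F' ⊆ M at x or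
  -- at y, and the only such edge is xy itself.
  edges-minimal : ∀ F' → F' ⊂E edges → ¬ IsEDS F'
  edges-minimal F' (F'⊆M , x , y , xy∈M , xy∉F') F'-eds =
    contradiction (trans (sym xy∈F') xy∉F') λ ()
    where
    xy∈F' : mem F' x y ≡ true
    xy∈F' with F'-eds x y (mem-adj edges x y xy∈M) xy∉F'
    ... | w , inj₁ xw∈F' =
      subst (λ z → mem F' x z ≡ true) (edges-functional x w y (F'⊆M x w xw∈F') xy∈M) xw∈F'
    ... | w , inj₂ yw∈F' = mem-sym F' y x
      (subst (λ z → mem F' y z ≡ true)
        (edges-functional y w x (F'⊆M y w yw∈F') (mem-sym edges x y xy∈M)) yw∈F')

  maximal⇒minimalEDS : Maximal → IsMinimalEDS edges
  maximal⇒minimalEDS maximal = maximal⇒EDS maximal , edges-minimal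

  degree-edges : ∀ x → degree edges x ≡ χ (is-just (partner M x))
  degree-edges x with partner M x
  ... | nothing = sum-replicate-zero (n Γ)
  ... | just z  = sum-δ z

  card-edges : Simple Γ → card edges + card edges ≡ ∑[ x < n Γ ] χ (is-just (partner M x))
  card-edges simple = trans (handshake simple edges) (sum-cong-≗ degree-edges)

record PerfectPairing (Γ : Graph) : Set where
  field
    mate            : Fin (n Γ) → Fin (n Γ)
    mate-involutive : ∀ x → mate (mate x) ≡ x
    mate-adj        : ∀ x → adj Γ x (mate x) ≡ true
open PerfectPairing public

module _ {Γ : Graph} (P : PerfectPairing Γ) where

  mate-swap : ∀ {x y} → mate P x ≡ y → mate P y ≡ x
  mate-swap {x} refl = mate-involutive P x

  mate-injective : ∀ {x y} → mate P x ≡ mate P y → x ≡ y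
  mate-injective {x} e = trans (sym (mate-involutive P x)) (mate-swap (sym e))

perfectPairing : ∀ {Γ} → HasPerfectMatching Γ → PerfectPairing Γ
perfectPairing {Γ} (M , has-unique-mate) = record
  { mate            = mate′
  ; mate-involutive = λ x → sym (unique (mate′ x) x (mem-sym M x (mate′ x) (matched x)))
  ; mate-adj        = λ x → mem-adj M x (mate′ x) (matched x)
  }
  where
  mate′ : Fin (n Γ) → Fin (n Γ)
  mate′ x = proj₁ (has-unique-mate x)
  matched : ∀ x → mem M x (mate′ x) ≡ true
  matched x = proj₁ (proj₂ (has-unique-mate x))
  unique : ∀ x y → mem M x y ≡ true → y ≡ mate′ x
  unique x = proj₂ (proj₂ (has-unique-mate x))

module _ {Γ : Graph} (P : PerfectPairing Γ) where

  pairing : Matching Γ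
  pairing = record
    { partner     = just ∘ mate P
    ; partner-sym = λ { x _ refl → cong just (mate-involutive P x) }
    ; partner-adj = λ { x _ refl → mate-adj P x }
    }

  pairing-maximal : Maximal pairing
  pairing-maximal _ _ _ ()

  card-pairing : Simple Γ → card (edges pairing) + card (edges pairing) ≡ n Γ
  card-pairing simple = trans (card-edges pairing simple) (sum-1 (n Γ))

-- Replace P inside an injective window by the partial matching σ of the window;
-- π records how P acts on the window, which keeps the outside P-closed.
module Patch {Γ : Graph} (P : PerfectPairing Γ) {k : ℕ}
  (window : Fin k → Fin (n Γ)) (window-injective : Injective _≡_ _≡_ window)
  (π : Fin k → Fin k) (mate-window : ∀ i → mate P (window i) ≡ window (π i))
  (σ : Fin k → Maybe (Fin k))
  (σ-sym : ∀ i j → σ i ≡ just j → σ j ≡ just i)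
  (σ-adj : ∀ i j → σ i ≡ just j → adj Γ (window i) (window j) ≡ true)
  where

  patchedPartner : Fin (n Γ) → Maybe (Fin (n Γ))
  patchedPartner x with any? (λ i → window i ≟ x)
  ... | yes (i , _) = map window (σ i)
  ... | no _        = just (mate P x)

  partner-window : ∀ i → patchedPartner (window i) ≡ map window (σ i)
  partner-window i with any? (λ j → window j ≟ window i)
  ... | yes (j , wj≡wi) = cong (map window ∘ σ) (window-injective wj≡wi)
  ... | no outside      = contradiction (i , refl) outside

  mate-outside : ∀ x → ¬ ∃ (λ i → window i ≡ x) → ¬ ∃ (λ i → window i ≡ mate P x)
  mate-outside x outside (i , wi≡mx) = outside (π i , (begin
    window (π i)        ≡⟨ sym (mate-window i) ⟩
    mate P (window i)   ≡⟨ cong (mate P) wi≡mx ⟩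
    mate P (mate P x)   ≡⟨ mate-involutive P x ⟩
    x                   ∎))
    where open ≡-Reasoning

  partner-outside : ∀ x → ¬ ∃ (λ i → window i ≡ x) → patchedPartner x ≡ just (mate P x)
  partner-outside x outside with any? (λ i → window i ≟ x)
  ... | yes inside = contradiction inside outside
  ... | no _       = refl

  patched-sym : ∀ x y → patchedPartner x ≡ just y → patchedPartner y ≡ just x
  patched-sym x y p with any? (λ i → window i ≟ x)
  ... | no outside with refl ← p = begin
    patchedPartner (mate P x) ≡⟨ partner-outside (mate P x) (mate-outside x outside) ⟩
    just (mate P (mate P x))  ≡⟨ cong just (mate-involutive P x) ⟩
    just x                    ∎
    where open ≡-Reasoning
  ... | yes (i , refl) with σ i in σi
  ...   | just j with refl ← p = trans (partner-window j) (cong (map window) (σ-sym i j σi))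

  patched-adj : ∀ x y → patchedPartner x ≡ just y → adj Γ x y ≡ true
  patched-adj x y p with any? (λ i → window i ≟ x)
  ... | no _ with refl ← p = mate-adj P x
  ... | yes (i , refl) with σ i in σi
  ...   | just j with refl ← p = σ-adj i j σi

  patched : Matching Γ
  patched = record { partner = patchedPartner ; partner-sym = patched-sym ; partner-adj = patched-adj }

  patched-unmatched : ∀ x → patchedPartner x ≡ nothing → ∃ λ i → window i ≡ x × σ i ≡ nothing
  patched-unmatched x p with any? (λ i → window i ≟ x)
  ... | yes (i , wi≡x) with σ i in σi
  ...   | nothing = i , wi≡x , σi

record AlternatingPath {Γ : Graph} (P : PerfectPairing Γ) : Set where
  field
    vertex           : Fin 6 → Fin (n Γ)
    vertex-injective : Injective _≡_ _≡_ vertex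
    mate-0           : mate P (vertex 0F) ≡ vertex 1F
    mate-2           : mate P (vertex 2F) ≡ vertex 3F
    mate-4           : mate P (vertex 4F) ≡ vertex 5F
    adj-1-2          : adj Γ (vertex 1F) (vertex 2F) ≡ true
    adj-3-4          : adj Γ (vertex 3F) (vertex 4F) ≡ true
    ends-nonadjacent : adj Γ (vertex 0F) (vertex 5F) ≡ false

module _ {Γ : Graph} (simple : Simple Γ) (P : PerfectPairing Γ) (path : AlternatingPath P) where
  open AlternatingPath path

  private
    π : Fin 6 → Fin 6
    π 0F = 1F
    π 1F = 0F
    π 2F = 3F
    π 3F = 2F
    π 4F = 5F
    π 5F = 4F

    mate-path : ∀ i → mate P (vertex i) ≡ vertex (π i)
    mate-path 0F = mate-0
    mate-path 1F = mate-swap P mate-0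
    mate-path 2F = mate-2
    mate-path 3F = mate-swap P mate-2
    mate-path 4F = mate-4
    mate-path 5F = mate-swap P mate-4

    σ : Fin 6 → Maybe (Fin 6)
    σ 0F = nothing
    σ 1F = just 2F
    σ 2F = just 1F
    σ 3F = just 4F
    σ 4F = just 3F
    σ 5F = nothing

    σ-sym : ∀ i j → σ i ≡ just j → σ j ≡ just i
    σ-sym 1F _ refl = refl
    σ-sym 2F _ refl = refl
    σ-sym 3F _ refl = refl
    σ-sym 4F _ refl = refl
    σ-sym 5F _ ()

    σ-adj : ∀ i j → σ i ≡ just j → adj Γ (vertex i) (vertex j) ≡ true
    σ-adj 1F _ refl = adj-1-2
    σ-adj 2F _ refl = adj-sym simple _ _ adj-1-2
    σ-adj 3F _ refl = adj-3-4
    σ-adj 4F _ refl = adj-sym simple _ _ adj-3-4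
    σ-adj 5F _ ()

    σ-unmatched : ∀ i → σ i ≡ nothing → i ≡ 0F ⊎ i ≡ 5F
    σ-unmatched 0F _ = inj₁ refl
    σ-unmatched 5F _ = inj₂ refl

  open Patch P vertex vertex-injective π mate-path σ σ-sym σ-adj

  switched : Matching Γ
  switched = patched

  switched-unmatched : ∀ x → partner switched x ≡ nothing → x ≡ vertex 0F ⊎ x ≡ vertex 5F
  switched-unmatched x px with patched-unmatched x px
  ... | i , refl , σi with σ-unmatched i σi
  ...   | inj₁ refl = inj₁ refl
  ...   | inj₂ refl = inj₂ refl

  switched-maximal : Maximal switched
  switched-maximal x y xy px py
    with switched-unmatched x px | switched-unmatched y py
  ... | inj₁ refl | inj₁ refl = adj⇒≢ simple xy refl
  ... | inj₂ refl | inj₂ refl = adj⇒≢ simple xy refl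
  ... | inj₁ refl | inj₂ refl = contradiction (trans (sym xy) ends-nonadjacent) λ ()
  ... | inj₂ refl | inj₁ refl =
    contradiction (trans (sym (adj-sym simple _ _ xy)) ends-nonadjacent) λ ()

  matched-or-end : ∀ x → χ (is-just (partner switched x)) + (χ (does (vertex 0F ≟ x)) + χ (does (vertex 5F ≟ x))) ≡ 1
  matched-or-end x = by-cases x (vertex 0F ≟ x) (vertex 5F ≟ x)
    where
    by-cases : ∀ x (end₀? : Dec (vertex 0F ≡ x)) (end₅? : Dec (vertex 5F ≡ x)) →
      χ (is-just (partner switched x)) + (χ (does end₀?) + χ (does end₅?)) ≡ 1
    by-cases _ (yes refl) (yes v5≡v0) = contradiction (vertex-injective v5≡v0) λ ()
    by-cases _ (yes refl) (no _)      rewrite partner-window 0F = refl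
    by-cases _ (no _)     (yes refl)  rewrite partner-window 5F = refl
    by-cases x (no x≢v0)  (no x≢v5)   with partner switched x in px
    ... | just _  = refl
    ... | nothing with switched-unmatched x px
    ...   | inj₁ refl = contradiction refl x≢v0
    ...   | inj₂ refl = contradiction refl x≢v5

  card-switched : card (edges switched) + card (edges switched) + 2 ≡ n Γ
  card-switched = begin
    card (edges switched) + card (edges switched) + 2
      ≡⟨ cong (_+ 2) (card-edges switched simple) ⟩
    ∑[ x < n Γ ] matched x + 2
      ≡⟨ cong₂ _+_ refl (cong₂ _+_ (sum-δ (vertex 0F)) (sum-δ (vertex 5F))) ⟨
    ∑[ x < n Γ ] matched x + (∑[ x < n Γ ] end₀ x + ∑[ x < n Γ ] end₅ x)
      ≡⟨ cong (∑[ x < n Γ ] matched x +_) (∑-distrib-+ end₀ end₅) ⟨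
    ∑[ x < n Γ ] matched x + ∑[ x < n Γ ] (end₀ x + end₅ x)
      ≡⟨ ∑-distrib-+ matched (λ x → end₀ x + end₅ x) ⟨
    ∑[ x < n Γ ] (matched x + (end₀ x + end₅ x))
      ≡⟨ sum-cong-≗ matched-or-end ⟩
    ∑[ x < n Γ ] 1
      ≡⟨ sum-1 (n Γ) ⟩
    n Γ ∎
    where
    open ≡-Reasoning
    matched end₀ end₅ : Fin (n Γ) → ℕ
    matched x = χ (is-just (partner switched x))
    end₀ x = χ (does (vertex 0F ≟ x))
    end₅ x = χ (does (vertex 5F ≟ x))

  alternatingPath⇒¬WED : ¬ WellEdgeDominated Γ
  alternatingPath⇒¬WED wed = m+1+n≢m (card (edges switched) + card (edges switched)) (begin
    card (edges switched) + card (edges switched) + 2 ≡⟨ card-switched ⟩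
    n Γ                                                ≡⟨ card-pairing P simple ⟨
    card (edges (pairing P)) + card (edges (pairing P)) ≡⟨ cong (λ c → c + c) same-card ⟨
    card (edges switched) + card (edges switched)      ∎)
    where
    open ≡-Reasoning
    same-card : card (edges switched) ≡ card (edges (pairing P))
    same-card = wed (edges switched) (edges (pairing P))
      (maximal⇒minimalEDS switched switched-maximal)
      (maximal⇒minimalEDS (pairing P) (pairing-maximal P))

distinct-pair : ∀ {k} → 2 ≤ k → Σ (Fin k) λ a → Σ (Fin k) λ b → a ≢ b
distinct-pair (s≤s (s≤s _)) = zero , suc zero , λ ()

-- punchIn a avoids a; inside its image, avoid the preimage of b as well.
outside-pair : ∀ {k} → 3 ≤ k → (a b : Fin k) → ∃ λ c → c ≢ a × c ≢ b
outside-pair (s≤s (s≤s (s≤s _))) a b with a ≟ b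
... | yes refl = punchIn a zero , punchInᵢ≢i a zero , punchInᵢ≢i a zero
... | no a≢b   = punchIn a (punchIn b′ zero) , punchInᵢ≢i a _ , λ c≡b →
  punchInᵢ≢i b′ zero (punchIn-injective a _ _ (trans c≡b (sym (punchIn-punchOut a≢b))))
  where b′ = punchOut a≢b

module _ {Γ : Graph} where

  leaving-edge : ∀ {S : Fin (n Γ) → Set} → Decidable S → ∀ {u v} → Reach Γ u v → S u → ¬ S v →
    ∃₂ λ x y → adj Γ x y ≡ true × S x × ¬ S y
  leaving-edge S? here Su ¬Su = contradiction Su ¬Su
  leaving-edge S? (step {w = w} uw w⇝v) Su ¬Sv with S? w
  ... | yes Sw = leaving-edge S? w⇝v Sw ¬Sv
  ... | no ¬Sw = _ , w , uw , Su , ¬Sw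

  some-edge : Connected Γ → 2 ≤ n Γ → ∃₂ λ a b → adj Γ a b ≡ true
  some-edge connected 2≤n with distinct-pair 2≤n
  ... | a , b , a≢b with leaving-edge (_≟ a) (connected a b) refl (a≢b ∘ sym)
  ...   | x , y , xy , _ = x , y , xy

  extend-edge : Connected Γ → 3 ≤ n Γ → ∀ a b →
    ∃ λ c → c ≢ a × c ≢ b × (adj Γ a c ≡ true ⊎ adj Γ b c ≡ true)
  extend-edge connected 3≤n a b with outside-pair 3≤n a b
  ... | d , d≢a , d≢b
    with leaving-edge (λ x → (x ≟ a) ⊎-dec (x ≟ b)) (connected a d) (inj₁ refl) [ d≢a , d≢b ]
  ...   | _ , c , xc , inj₁ refl , c∉ = c , c∉ ∘ inj₁ , c∉ ∘ inj₂ , inj₁ xc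
  ...   | _ , c , xc , inj₂ refl , c∉ = c , c∉ ∘ inj₁ , c∉ ∘ inj₂ , inj₂ xc

  path-of-three : Simple Γ → Connected Γ → 3 ≤ n Γ →
    ∃ λ a → ∃₂ λ b c → adj Γ a b ≡ true × adj Γ b c ≡ true × a ≢ c
  path-of-three simple connected 3≤n with some-edge connected (<⇒≤ 3≤n)
  ... | a , b , ab with extend-edge connected 3≤n a b
  ...   | c , _   , c≢b , inj₁ ac = b , a , c , adj-sym simple a b ab , ac , c≢b ∘ sym
  ...   | c , c≢a , _   , inj₂ bc = a , b , c , ab , bc , c≢a ∘ sym

  pairing-extends : Connected Γ → 3 ≤ n Γ → (P : PerfectPairing Γ) →
    ∃₂ λ g₀ g₂ → g₂ ≢ g₀ × g₂ ≢ mate P g₀ × adj Γ (mate P g₀) g₂ ≡ true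
  pairing-extends connected 3≤n P with distinct-pair (<⇒≤ 3≤n)
  ... | g , _ with extend-edge connected 3≤n g (mate P g)
  ...   | c , c≢g , c≢g′ , inj₂ g′c = g , c , c≢g , c≢g′ , g′c
  ...   | c , c≢g , c≢g′ , inj₁ gc  = mate P g , c , c≢g′ ,
    subst (c ≢_) (sym (mate-involutive P g)) c≢g ,
    subst (λ x → adj Γ x c ≡ true) (sym (mate-involutive P g)) gc

injective-by-inspection : ∀ {k} {A : Set} (_≟ᴬ_ : DecidableEquality A) (f : Fin k → A) →
  {True (all? λ i → all? λ j → (f i ≟ᴬ f j) →-dec (i ≟ j))} → Injective _≡_ _≡_ f
injective-by-inspection _ _ {checked} {i} {j} = toWitness checked i j

module _ {G H : Graph} where

  ∀-combine : ∀ {Q : Fin (n G * n H) → Set} → (∀ (g : Fin (n G)) (h : Fin (n H)) → Q (combine g h)) →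
    ∀ x → Q x
  ∀-combine {Q} q x = subst Q (combine-remQuot {n G} (n H) x) (q _ _)

  □-adj : ∀ g h g′ h′ → adj (G □ H) (combine g h) (combine g′ h′) ≡
    (⌊ g ≟ g′ ⌋ ∧ adj H h h′) ∨ (⌊ h ≟ h′ ⌋ ∧ adj G g g′)
  □-adj g h g′ h′ = cong₂ formula (remQuot-combine g h) (remQuot-combine g′ h′)
    where
    formula : Fin (n G) × Fin (n H) → Fin (n G) × Fin (n H) → Bool
    formula (g , h) (g′ , h′) = (⌊ g ≟ g′ ⌋ ∧ adj H h h′) ∨ (⌊ h ≟ h′ ⌋ ∧ adj G g g′)

  □-adj-vertical : ∀ {g h h′} → adj H h h′ ≡ true → adj (G □ H) (combine g h) (combine g h′) ≡ true
  □-adj-vertical {g} {h} {h′} hh′ rewrite □-adj g h g h′ | ≡-≟-identity _≟_ (refl {x = g}) | hh′ = refl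

  □-adj-horizontal : ∀ {g g′ h} → adj G g g′ ≡ true → adj (G □ H) (combine g h) (combine g′ h) ≡ true
  □-adj-horizontal {g} {g′} {h} gg′ rewrite □-adj g h g′ h | ≡-≟-identity _≟_ (refl {x = h}) | gg′ =
    ∨-zeroʳ _

  □-nonadjacent : ∀ {g g′ h h′} → g ≢ g′ → h ≢ h′ → adj (G □ H) (combine g h) (combine g′ h′) ≡ false
  □-nonadjacent {g} {g′} {h} {h′} g≢g′ h≢h′
    rewrite □-adj g h g′ h′ | dec-no (g ≟ g′) g≢g′ | dec-no (h ≟ h′) h≢h′ = refl

  □-adj-cases : ∀ g h g′ h′ → adj (G □ H) (combine g h) (combine g′ h′) ≡ true →
    (g ≡ g′ × adj H h h′ ≡ true) ⊎ (h ≡ h′ × adj G g g′ ≡ true)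
  □-adj-cases g h g′ h′ e rewrite □-adj g h g′ h′
    with g ≟ g′ | adj H h h′ | h ≟ h′ | adj G g g′
  ... | yes g≡g′ | true  | _        | _     = inj₁ (g≡g′ , refl)
  ... | _        | _     | yes h≡h′ | true  = inj₂ (h≡h′ , refl)
  ... | no _     | _     | no _     | _     = contradiction e λ ()
  ... | yes _    | false | no _     | _     = contradiction e λ ()
  ... | no _     | _     | yes _    | false = contradiction e λ ()
  ... | yes _    | false | yes _    | false = contradiction e λ ()

  □-simple : Simple G → Simple H → Simple (G □ H)
  □-simple simple-G simple-H = record
    { adj-sym   = ∀-combine λ g h → ∀-combine (symmetric g h)
    ; adj-irref = ∀-combine irreflexive
    }
    where
    symmetric : ∀ g h g′ h′ → adj (G □ H) (combine g h) (combine g′ h′) ≡ true →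
      adj (G □ H) (combine g′ h′) (combine g h) ≡ true
    symmetric g h g′ h′ e with □-adj-cases g h g′ h′ e
    ... | inj₁ (refl , hh′) = □-adj-vertical (adj-sym simple-H _ _ hh′)
    ... | inj₂ (refl , gg′) = □-adj-horizontal (adj-sym simple-G _ _ gg′)
    irreflexive : ∀ g h → adj (G □ H) (combine g h) (combine g h) ≡ false
    irreflexive g h rewrite □-adj g h g h | adj-irref simple-H h | adj-irref simple-G g =
      cong₂ _∨_ (∧-zeroʳ ⌊ g ≟ g ⌋) (∧-zeroʳ ⌊ h ≟ h ⌋)

  □-mate : PerfectPairing G → Fin (n G * n H) → Fin (n G * n H)
  □-mate P x = combine (mate P (quotient (n H) x)) (remainder {n G} (n H) x)

  □-mate-combine : ∀ P g h → □-mate P (combine g h) ≡ combine (mate P g) h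
  □-mate-combine P g h = cong (λ (g , h) → combine (mate P g) h) (remQuot-combine g h)

  □-pairing : PerfectPairing G → PerfectPairing (G □ H)
  □-pairing P = record
    { mate            = □-mate P
    ; mate-involutive = ∀-combine λ g h → begin
        □-mate P (□-mate P (combine g h)) ≡⟨ cong (□-mate P) (□-mate-combine P g h) ⟩
        □-mate P (combine (mate P g) h)   ≡⟨ □-mate-combine P (mate P g) h ⟩
        combine (mate P (mate P g)) h     ≡⟨ cong (λ g′ → combine g′ h) (mate-involutive P g) ⟩
        combine g h                       ∎
    ; mate-adj        = ∀-combine λ g h →
        subst (λ y → adj (G □ H) (combine g h) y ≡ true) (sym (□-mate-combine P g h))
          (□-adj-horizontal (mate-adj P g))
    }
    where open ≡-Reasoning

  grid : ∀ {k l} → Vec (Fin (n G)) k → Vec (Fin (n H)) l → Fin k × Fin l → Fin (n G * n H)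
  grid γ η (i , j) = combine (lookup γ i) (lookup η j)

  grid-injective : ∀ {k l} {γ : Vec (Fin (n G)) k} {η : Vec (Fin (n H)) l} →
    Unique γ → Unique η → Injective _≡_ _≡_ (grid γ η)
  grid-injective {γ = γ} {η} γ-unique η-unique {i , j} {i′ , j′} same = cong₂ _,_
    (lookup-injective γ-unique i i′ (combine-injectiveˡ (lookup γ i) (lookup η j) _ _ same))
    (lookup-injective η-unique j j′ (combine-injectiveʳ (lookup γ i) (lookup η j) _ _ same))

  path-across-H : Simple G → Simple H → (P : PerfectPairing G) (g : Fin (n G)) {a b c : Fin (n H)} →
    adj H a b ≡ true → adj H b c ≡ true → a ≢ c → AlternatingPath (□-pairing P)
  path-across-H simple-G simple-H P g {a} {b} {c} ab bc a≢c = record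
    { vertex           = grid γ η ∘ shape
    ; vertex-injective = shape-injective ∘ grid-injective γ-unique η-unique
    ; mate-0           = mate-swap (□-pairing P) (□-mate-combine P g a)
    ; mate-2           = □-mate-combine P g b
    ; mate-4           = mate-swap (□-pairing P) (□-mate-combine P g c)
    ; adj-1-2          = □-adj-vertical ab
    ; adj-3-4          = □-adj-vertical bc
    ; ends-nonadjacent = □-nonadjacent (adj⇒≢ simple-G (mate-adj P g) ∘ sym) a≢c
    }
    where
    γ = g ∷ mate P g ∷ []
    η = a ∷ b ∷ c ∷ []
    γ-unique : Unique γ
    γ-unique = (adj⇒≢ simple-G (mate-adj P g) ∷ []) ∷ [] ∷ []
    η-unique : Unique η
    η-unique = (adj⇒≢ simple-H ab ∷ a≢c ∷ []) ∷ (adj⇒≢ simple-H bc ∷ []) ∷ [] ∷ []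
    shape : Fin 6 → Fin 2 × Fin 3
    shape 0F = 1F , 0F
    shape 1F = 0F , 0F
    shape 2F = 0F , 1F
    shape 3F = 1F , 1F
    shape 4F = 1F , 2F
    shape 5F = 0F , 2F
    shape-injective : Injective _≡_ _≡_ shape
    shape-injective = injective-by-inspection (≡-dec _≟_ _≟_) shape

  path-across-G : Simple G → Simple H → (P : PerfectPairing G) {g₀ g₂ : Fin (n G)} →
    g₂ ≢ g₀ → g₂ ≢ mate P g₀ → adj G (mate P g₀) g₂ ≡ true →
    {a b : Fin (n H)} → adj H a b ≡ true → AlternatingPath (□-pairing P)
  path-across-G simple-G simple-H P {g₀} {g₂} g₂≢g₀ g₂≢g₁ g₁g₂ {a} {b} ab = record
    { vertex           = grid γ η ∘ shape
    ; vertex-injective = shape-injective ∘ grid-injective γ-unique η-unique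
    ; mate-0           = □-mate-combine P g₀ a
    ; mate-2           = □-mate-combine P g₂ a
    ; mate-4           = mate-swap (□-pairing P) (□-mate-combine P g₂ b)
    ; adj-1-2          = □-adj-horizontal g₁g₂
    ; adj-3-4          = □-adj-vertical ab
    ; ends-nonadjacent = □-nonadjacent (g₂≢g₀ ∘ sym) (adj⇒≢ simple-H ab)
    }
    where
    γ = g₀ ∷ mate P g₀ ∷ g₂ ∷ mate P g₂ ∷ []
    η = a ∷ b ∷ []
    g₀≢g₃ : g₀ ≢ mate P g₂
    g₀≢g₃ g₀≡g₃ = g₂≢g₁ (sym (mate-swap P (sym g₀≡g₃)))
    g₁≢g₃ : mate P g₀ ≢ mate P g₂
    g₁≢g₃ g₁≡g₃ = g₂≢g₀ (sym (mate-injective P g₁≡g₃))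
    γ-unique : Unique γ
    γ-unique = (adj⇒≢ simple-G (mate-adj P g₀) ∷ g₂≢g₀ ∘ sym ∷ g₀≢g₃ ∷ [])
             ∷ (g₂≢g₁ ∘ sym ∷ g₁≢g₃ ∷ [])
             ∷ (adj⇒≢ simple-G (mate-adj P g₂) ∷ [])
             ∷ [] ∷ []
    η-unique : Unique η
    η-unique = (adj⇒≢ simple-H ab ∷ []) ∷ [] ∷ []
    shape : Fin 6 → Fin 4 × Fin 2
    shape 0F = 0F , 0F
    shape 1F = 1F , 0F
    shape 2F = 2F , 0F
    shape 3F = 3F , 0F
    shape 4F = 3F , 1F
    shape 5F = 2F , 1F
    shape-injective : Injective _≡_ _≡_ shape
    shape-injective = injective-by-inspection (≡-dec _≟_ _≟_) shape

lemma14 : (G H : Graph) → Simple G → Simple H → Connected G → Connected H →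
    2 ≤ n G → 2 ≤ n H → (3 ≤ n G ⊎ 3 ≤ n H) →
    HasPerfectMatching G → ¬ WellEdgeDominated (G □ H)
lemma14 G H simple-G simple-H connected-G connected-H 2≤nG 2≤nH large perfect =
  alternatingPath⇒¬WED (□-simple simple-G simple-H) (□-pairing {H = H} P) (path large)
  where
  P = perfectPairing perfect
  path : 3 ≤ n G ⊎ 3 ≤ n H → AlternatingPath (□-pairing {H = H} P)
  path (inj₁ 3≤nG) with pairing-extends connected-G 3≤nG P | some-edge connected-H 2≤nH
  ... | _ , _ , g₂≢g₀ , g₂≢g₁ , g₁g₂ | _ , _ , ab = path-across-G simple-G simple-H P g₂≢g₀ g₂≢g₁ g₁g₂ ab
  path (inj₂ 3≤nH) with path-of-three simple-H connected-H 3≤nH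
  ... | _ , _ , _ , ab , bc , a≢c = path-across-H simple-G simple-H P (proj₁ (distinct-pair 2≤nG)) ab bc a≢c
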